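{- Let $D=(d_1,\ldots,d_n)$ be a sequence of positive integers with $d_1\ge\ldots\ge d_n$ satisfying the strict inequalities $$\sum_{i=1}^kd_i<k(k-1)+\sum_{i=k+1}^n\min\{k,d_i\}\quad\text{for } k=1,\ldots,n.$$ Then $\mathcal{P}(D)$ has a non-empty interior, i.e. there is $y=(\eta_{\{j,k\}})\in\mathcal{P}(D)$ with $0<\eta_{\{j,k\}}<1$ for all $1\le j\ne k\le n$.
   Context: $\mathcal{P}(D)\subset\mathbb{R}^{\binom n2}$, with coordinates indexed by unordered pairs $\{j,k\}$, $1\le j\ne k\le n$, is the set of $x=(\xi_{\{j,k\}})$ with $\sum_{j:\,j\ne k}\xi_{\{j,k\}}=d_k$ for $k=1,\ldots,n$ and $0\le\xi_{\{j,k\}}\le1$. -}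

module Defs where

open import Data.Nat as ℕ using (ℕ; zero; suc; _⊓_; _∸_; _≤_; _<_)
open import Data.Fin using (Fin; toℕ; _≟_)
import Data.Fin as F
open import Data.Rational as ℚ using (ℚ; 0ℚ; 1ℚ)
open import Relation.Nullary using (yes; no; ¬_)
open import Relation.Nullary.Decidable using (⌊_⌋)
open import Relation.Binary.PropositionalEquality using (_≡_)
open import Data.Product using (Σ; _×_)
import Data.Integer as ℤ
open import Data.Bool using (if_then_else_)

sumℕ : ∀ {n} → (Fin n → ℕ) → ℕ
sumℕ {zero} f = 0
sumℕ {suc n} f = f F.zero ℕ.+ sumℕ (λ i → f (F.suc i))

sumℚ : ∀ {n} → (Fin n → ℚ) → ℚ
sumℚ {zero} f = 0ℚ
sumℚ {suc n} f = f F.zero ℚ.+ sumℚ (λ i → f (F.suc i))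

-- Indices are 0-based: paper's d_{i+1} is d i for i : Fin n.
-- Nonincreasing: d_1 ≥ … ≥ d_n.
NonIncreasing : ∀ {n} → (Fin n → ℕ) → Set
NonIncreasing {n} d = ∀ (i j : Fin n) → toℕ i ≤ toℕ j → d j ≤ d i

-- Σ_{i=1}^k d_i  (paper indices 1..k are Fin indices 0..k-1)
headSum : ∀ {n} → (Fin n → ℕ) → ℕ → ℕ
headSum d k = sumℕ (λ i → if ⌊ toℕ i ℕ.<? k ⌋ then d i else 0)

tailMinSum : ∀ {n} → (Fin n → ℕ) → ℕ → ℕ
tailMinSum d k = sumℕ (λ i → if ⌊ toℕ i ℕ.<? k ⌋ then 0 else k ⊓ d i)

StrictConditions : ∀ {n} → (Fin n → ℕ) → Set
StrictConditions {n} d =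
  ∀ (k : ℕ) → 1 ≤ k → k ≤ n → headSum d k < k ℕ.* (k ∸ 1) ℕ.+ tailMinSum d k

-- A point of ℝ^{(n choose 2)} is represented as a symmetric function
-- ξ : Fin n → Fin n → ℚ whose diagonal values are ignored.
Symmetric : ∀ {n} → (Fin n → Fin n → ℚ) → Set
Symmetric {n} ξ = ∀ (j k : Fin n) → ξ j k ≡ ξ k j

degreeAt : ∀ {n} → (Fin n → Fin n → ℚ) → Fin n → ℚ
degreeAt ξ k = sumℚ (λ j → if ⌊ j ≟ k ⌋ then 0ℚ else ξ j k)

InP : ∀ {n} → (Fin n → ℕ) → (Fin n → Fin n → ℚ) → Set
InP {n} d ξ =
  Symmetric ξ
  × (∀ (k : Fin n) → degreeAt ξ k ≡ ((ℤ.+ d k) ℚ./ 1))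
  × (∀ (j k : Fin n) → ¬ (j ≡ k) → (0ℚ ℚ.≤ ξ j k × ξ j k ℚ.≤ 1ℚ))

StrictlyInside : ∀ {n} → (Fin n → Fin n → ℚ) → Set
StrictlyInside {n} ξ = ∀ (j k : Fin n) → ¬ (j ≡ k) → (0ℚ ℚ.< ξ j k × ξ j k ℚ.< 1ℚ)

-- Put P = 3n² and D = 3 + 2P. If x is an integer matrix with zero diagonal, 0 ≤ x_jk ≤ P, and all
-- row and column sums equal to R_k = (2 + P)d_k − (n − 1), then η_jk = (2 + x_jk + x_kj)/(D + 1) is
-- symmetric, lies strictly between 0 and 1, and has degree (2(n − 1) + 2R_k)/(4 + 2P) = d_k at k.
--
-- Such an x is a flow in the transportation problem with capacity P off the diagonal, so by Gale's
-- supply–demand theorem it exists once R(X) ≤ R(Y) + P·#{(u, w) : u ∈ X, w ∉ Y, u ≠ w} for all X, Y.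
-- When X ⊄ Y this follows from d(X) < d(Y) + #{…}, which is the strict inequality for k = |X ∖ Y|
-- transported from the first k indices to the set X ∖ Y (possible because d is sorted); P = 3n² is
-- large enough to absorb the remaining terms. When X ⊊ Y it follows from the positivity of d.
--
-- Gale's theorem is proved by induction on the arcs: the arc (a, b) carries the largest slack
-- R(X) − C(Y) − c′(X, Yᶜ) over the pairs with a ∈ X and b ∉ Y, where c′ is c with the arc removed,
-- and supermodularity of the slack shows that the remaining arcs still satisfy Gale's condition.

module Submission where

open import Defs
open import Data.Nat using (ℕ)
open import Data.Fin using (Fin)
open import Data.Rational using (ℚ; 0ℚ; 1ℚ)
open import Data.Product using (Σ; _×_)

open import Algebra.Bundles using (CommutativeMonoid; Semiring)
open import Data.Bool using (Bool; true; false; if_then_else_; _∧_; _∨_; not; T)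
import Data.Bool as Bool
open import Data.Empty using (⊥)
open import Data.Fin using (zero; suc; _≟_)
open import Data.List using (List; []; _∷_; cartesianProduct; allFin)
open import Data.List.Membership.Propositional.Properties using (∈-cartesianProduct⁺; ∈-allFin)
open import Data.List.Membership.Propositional using (_∈_)
open import Data.List.Relation.Unary.Any using (here; there)
open import Data.Product using (_,_; proj₁; proj₂)
open import Data.Sum using (_⊎_; inj₁; inj₂)
open import Data.Vec.Functional using (Vector)
open import Function using (_∘_)
open import Relation.Nullary.Decidable using (does; yes; no; ⌊_⌋; isYes≗does; dec-true; dec-false)
open import Relation.Nullary.Negation using (contradiction)
open import Relation.Binary.PropositionalEquality
  using (_≡_; _≢_; _≗_; refl; sym; trans; cong; cong₂; subst; subst₂; module ≡-Reasoning)
import Data.Nat as ℕ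
import Data.Nat.Properties as ℕₚ
import Data.Vec.Functional as Vector
import Data.Integer as ℤ
import Data.Integer.Properties as ℤₚ
import Data.Rational as ℚ
import Data.Rational.Properties as ℚₚ

_∪_ _∩_ _∖_ : ∀ {n} → (Fin n → Bool) → (Fin n → Bool) → Fin n → Bool
(X ∪ Y) i = X i ∨ Y i
(X ∩ Y) i = X i ∧ Y i
(X ∖ Y) i = X i ∧ not (Y i)

｛_｝ : ∀ {n} → Fin n → Fin n → Bool
｛ a ｝ i = does (i ≟ a)

module IndicatorSums {c ℓ} (M : CommutativeMonoid c ℓ) where
  open CommutativeMonoid M
    using (Carrier; _≈_; setoid; reflexive; identityˡ; identityʳ; comm)
    renaming (_∙_ to _+_; ε to 0#; ∙-congˡ to +-congˡ; refl to ≈-refl; trans to ≈-trans; sym to ≈-sym)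
  open import Algebra.Properties.CommutativeMonoid.Sum M
  open import Relation.Binary.Reasoning.Setoid setoid

  infixr 11 [_]·_
  [_]·_ : Bool → Carrier → Carrier
  [ b ]· x = if b then x else 0#

  weight : ∀ {n} → (Fin n → Bool) → Vector Carrier n → Carrier
  weight {n} X f = ∑[ i < n ] [ X i ]· f i

  ∑-[]· : ∀ {n} b (f : Vector Carrier n) → ∑[ i < n ] [ b ]· f i ≈ [ b ]· sum f
  ∑-[]· true  f = ≈-refl
  ∑-[]· {n} false f = sum-replicate-zero n

  weight-｛｝ : ∀ {n} (a : Fin n) (f : Vector Carrier n) → weight ｛ a ｝ f ≈ f a
  weight-｛｝ {ℕ.suc n} zero    f = ≈-trans (+-congˡ (sum-replicate-zero n)) (identityʳ _)
  weight-｛｝ {ℕ.suc n} (suc a) f = ≈-trans (identityˡ _) (weight-｛｝ a (f ∘ suc))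

  cut : ∀ {m n} → (Fin m → Fin n → Carrier) → (Fin m → Bool) → (Fin n → Bool) → Carrier
  cut {m} {n} c X Y = ∑[ u < m ] ∑[ w < n ] [ X u ∧ not (Y w) ]· c u w

  cut-congᶜ : ∀ {m n} {c d : Fin m → Fin n → Carrier} → (∀ u w → c u w ≡ d u w) →
              ∀ X Y → cut c X Y ≡ cut d X Y
  cut-congᶜ c≡d X Y = sum-cong-≗ (λ u → sum-cong-≗ (λ w → cong ([ X u ∧ not (Y w) ]·_) (c≡d u w)))

  cut-cong : ∀ {m n} (c : Fin m → Fin n → Carrier) {X X′ Y Y′} → X ≗ X′ → Y ≗ Y′ → cut c X Y ≡ cut c X′ Y′
  cut-cong c X≗X′ Y≗Y′ = sum-cong-≗ (λ u → sum-cong-≗ (λ w →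
    cong₂ (λ p q → [ p ∧ not q ]· c u w) (X≗X′ u) (Y≗Y′ w)))

  []·-zero : ∀ p → [ p ]· 0# ≡ 0#
  []·-zero true  = refl
  []·-zero false = refl

  []·-∧ : ∀ p q {x} → [ p ∧ q ]· x ≡ [ p ]· [ q ]· x
  []·-∧ true  _ = refl
  []·-∧ false _ = refl

  []·-comm : ∀ p q {x} → [ p ]· [ q ]· x ≡ [ q ]· [ p ]· x
  []·-comm true  true  = refl
  []·-comm true  false = refl
  []·-comm false true  = refl
  []·-comm false false = refl

  weight-δ : ∀ {n} (X : Fin n → Bool) (a : Fin n) x → weight X (λ i → [ ｛ a ｝ i ]· x) ≈ [ X a ]· x
  weight-δ X a x = ≈-trans (reflexive (sum-cong-≗ (λ i → []·-comm (X i) (｛ a ｝ i))))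
                           (weight-｛｝ a (λ i → [ X i ]· x))

  weight-cong : ∀ {n} {X Y : Fin n → Bool} → X ≗ Y → ∀ f → weight X f ≡ weight Y f
  weight-cong X≗Y f = sum-cong-≗ (λ i → cong (λ b → [ b ]· f i) (X≗Y i))

  weight-modular : ∀ {n} (X Y : Fin n → Bool) (f : Vector Carrier n) →
                   weight X f + weight Y f ≈ weight (X ∪ Y) f + weight (X ∩ Y) f
  weight-modular {n} X Y f = begin
    weight X f + weight Y f
      ≈⟨ ∑-distrib-+ (λ i → [ X i ]· f i) (λ i → [ Y i ]· f i) ⟨
    ∑[ i < n ] ([ X i ]· f i + [ Y i ]· f i)
      ≈⟨ sum-cong-≋ (λ i → pointwise (X i) (Y i) (f i)) ⟩
    ∑[ i < n ] ([ X i ∨ Y i ]· f i + [ X i ∧ Y i ]· f i)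
      ≈⟨ ∑-distrib-+ (λ i → [ X i ∨ Y i ]· f i) (λ i → [ X i ∧ Y i ]· f i) ⟩
    weight (X ∪ Y) f + weight (X ∩ Y) f
      ∎
    where
    pointwise : ∀ p q x → [ p ]· x + [ q ]· x ≈ [ p ∨ q ]· x + [ p ∧ q ]· x
    pointwise true  _     _ = ≈-refl
    pointwise false true  x = comm 0# x
    pointwise false false _ = ≈-refl

  weight-+ : ∀ {n} (X : Fin n → Bool) (f g : Vector Carrier n) →
             weight X (λ i → f i + g i) ≈ weight X f + weight X g
  weight-+ X f g = ≈-trans (sum-cong-≋ (λ i → pointwise (X i)))
                           (∑-distrib-+ (λ i → [ X i ]· f i) (λ i → [ X i ]· g i))
    where
    pointwise : ∀ p {x y} → [ p ]· (x + y) ≈ [ p ]· x + [ p ]· y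
    pointwise true  = ≈-refl
    pointwise false = ≈-sym (identityˡ 0#)

  weight-∁ : ∀ {n} (X : Fin n → Bool) (f : Vector Carrier n) → weight X f + weight (not ∘ X) f ≈ sum f
  weight-∁ {n} X f = ≈-trans (≈-sym (∑-distrib-+ (λ i → [ X i ]· f i) (λ i → [ not (X i) ]· f i)))
                             (sum-cong-≋ (λ i → pointwise (X i) (f i)))
    where
    pointwise : ∀ p x → [ p ]· x + [ not p ]· x ≈ x
    pointwise true  x = identityʳ x
    pointwise false x = identityˡ x

module ℕΣ where
  open import Algebra.Properties.Semiring.Sum ℕₚ.+-*-semiring public
  open IndicatorSums (Semiring.+-commutativeMonoid ℕₚ.+-*-semiring) public

  ∑-mono : ∀ {n} {f g : Vector ℕ n} → (∀ i → f i ℕ.≤ g i) → sum f ℕ.≤ sum g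
  ∑-mono {ℕ.zero}  f≤g = ℕ.z≤n
  ∑-mono {ℕ.suc n} f≤g = ℕₚ.+-mono-≤ (f≤g zero) (∑-mono (f≤g ∘ suc))

module ℤΣ where
  open import Data.Integer using (ℤ; 0ℤ; 1ℤ; _+_; _-_; -_; _*_; _≤_)
  open import Algebra.Properties.Semiring.Sum ℤₚ.+-*-semiring public
  open IndicatorSums (Semiring.+-commutativeMonoid ℤₚ.+-*-semiring) public

  ∑-mono : ∀ {n} {f g : Vector ℤ n} → (∀ i → f i ≤ g i) → sum f ≤ sum g
  ∑-mono {ℕ.zero}  f≤g = ℤₚ.≤-refl
  ∑-mono {ℕ.suc n} f≤g = ℤₚ.+-mono-≤ (f≤g zero) (∑-mono (f≤g ∘ suc))

  ∑-neg : ∀ {n} (f : Vector ℤ n) → ∑[ i < n ] (- f i) ≡ - sum f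
  ∑-neg {ℕ.zero}  f = refl
  ∑-neg {ℕ.suc n} f = trans (cong (- f zero +_) (∑-neg (f ∘ suc))) (sym (ℤₚ.neg-distrib-+ (f zero) _))

  ∑-distrib-difference : ∀ {n} (f g : Vector ℤ n) → ∑[ i < n ] (f i - g i) ≡ sum f - sum g
  ∑-distrib-difference f g = trans (∑-distrib-+ f (-_ ∘ g)) (cong (sum f +_) (∑-neg g))

  []·-nonneg : ∀ p {x} → 0ℤ ≤ x → 0ℤ ≤ [ p ]· x
  []·-nonneg true  0≤x = 0≤x
  []·-nonneg false _   = ℤₚ.≤-refl

  []·-mono : ∀ p {x y} → x ≤ y → [ p ]· x ≤ [ p ]· y
  []·-mono true  x≤y = x≤y
  []·-mono false _   = ℤₚ.≤-refl

  []·-count : ∀ p₁ p₂ q₁ q₂ {c} → 0ℤ ≤ c → [ p₁ ]· 1ℤ + [ p₂ ]· 1ℤ ≤ [ q₁ ]· 1ℤ + [ q₂ ]· 1ℤ →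
              [ p₁ ]· c + [ p₂ ]· c ≤ [ q₁ ]· c + [ q₂ ]· c
  []·-count p₁ p₂ q₁ q₂ {c} 0≤c count = begin
    [ p₁ ]· c + [ p₂ ]· c               ≡⟨ cong₂ _+_ (scaled p₁) (scaled p₂) ⟩
    c * [ p₁ ]· 1ℤ + c * [ p₂ ]· 1ℤ     ≡⟨ ℤₚ.*-distribˡ-+ c _ _ ⟨
    c * ([ p₁ ]· 1ℤ + [ p₂ ]· 1ℤ)       ≤⟨ ℤₚ.*-monoˡ-≤-nonNeg c {{ℤ.nonNegative 0≤c}} count ⟩
    c * ([ q₁ ]· 1ℤ + [ q₂ ]· 1ℤ)       ≡⟨ ℤₚ.*-distribˡ-+ c _ _ ⟩
    c * [ q₁ ]· 1ℤ + c * [ q₂ ]· 1ℤ     ≡⟨ cong₂ _+_ (scaled q₁) (scaled q₂) ⟨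
    [ q₁ ]· c + [ q₂ ]· c               ∎
    where
    open ℤₚ.≤-Reasoning
    scaled : ∀ p → [ p ]· c ≡ c * [ p ]· 1ℤ
    scaled true  = sym (ℤₚ.*-identityʳ c)
    scaled false = sym (ℤₚ.*-zeroʳ c)

  ∑∑-distrib-+ : ∀ {m n} (f g : Fin m → Fin n → ℤ) →
                 ∑[ u < m ] ∑[ w < n ] (f u w + g u w)
                   ≡ ∑[ u < m ] ∑[ w < n ] f u w + ∑[ u < m ] ∑[ w < n ] g u w
  ∑∑-distrib-+ f g = trans (sum-cong-≗ (λ u → ∑-distrib-+ (f u) (g u)))
                           (∑-distrib-+ (λ u → sum (f u)) (λ u → sum (g u)))

  weight-difference : ∀ {n} (X : Fin n → Bool) (f g : Vector ℤ n) →
             weight X (λ i → f i - g i) ≡ weight X f - weight X g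
  weight-difference X f g = trans (sum-cong-≗ (λ i → pointwise (X i)))
                         (∑-distrib-difference (λ i → [ X i ]· f i) (λ i → [ X i ]· g i))
    where
    pointwise : ∀ p {x y} → [ p ]· (x - y) ≡ [ p ]· x - [ p ]· y
    pointwise true  = refl
    pointwise false = refl

≤-shift : ∀ {i j} k {i′ j′} → i ℤ.≤ j → i ℤ.+ k ≡ i′ → j ℤ.+ k ≡ j′ → i′ ℤ.≤ j′
≤-shift k i≤j refl refl = ℤₚ.+-monoˡ-≤ k i≤j

module SupplyDemand where
  open import Data.Integer using (ℤ; 0ℤ; 1ℤ; _+_; _-_; -_; _≤_; _⊔_)
  open import Data.Integer.Tactic.RingSolver using (solve-∀)
  open ℤΣ

  GaleCondition : ∀ {m n} → (Fin m → Fin n → ℤ) → (Fin m → ℤ) → (Fin n → ℤ) → Set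
  GaleCondition c R C = ∀ X Y → weight X R ≤ weight Y C + cut c X Y

  record IsFlow {m n} (c : Fin m → Fin n → ℤ) (R : Fin m → ℤ) (C : Fin n → ℤ)
                (x : Fin m → Fin n → ℤ) : Set where
    field
      nonneg  : ∀ u w → 0ℤ ≤ x u w
      bounded : ∀ u w → x u w ≤ c u w
      rowSum  : ∀ u → ∑[ w < n ] x u w ≡ R u
      colSum  : ∀ w → ∑[ u < m ] x u w ≡ C w

  arc : ∀ {m n} → Fin m → Fin n → ℤ → Fin m → Fin n → ℤ
  arc a b v u w = [ ｛ a ｝ u ∧ ｛ b ｝ w ]· v

  ∑-arc-row : ∀ {m n} (a : Fin m) (b : Fin n) v u → ∑[ w < n ] arc a b v u w ≡ [ ｛ a ｝ u ]· v
  ∑-arc-row a b v u = begin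
    ∑[ w < _ ] [ ｛ a ｝ u ∧ ｛ b ｝ w ]· v     ≡⟨ sum-cong-≗ (λ w → []·-∧ (｛ a ｝ u) (｛ b ｝ w)) ⟩
    ∑[ w < _ ] [ ｛ a ｝ u ]· [ ｛ b ｝ w ]· v  ≡⟨ ∑-[]· (｛ a ｝ u) (λ w → [ ｛ b ｝ w ]· v) ⟩
    [ ｛ a ｝ u ]· weight ｛ b ｝ (λ _ → v)     ≡⟨ cong ([ ｛ a ｝ u ]·_) (weight-｛｝ b (λ _ → v)) ⟩
    [ ｛ a ｝ u ]· v                           ∎
    where open ≡-Reasoning

  ∑-arc-col : ∀ {m n} (a : Fin m) (b : Fin n) v w → ∑[ u < m ] arc a b v u w ≡ [ ｛ b ｝ w ]· v
  ∑-arc-col a b v w = trans (sum-cong-≗ (λ u → []·-∧ (｛ a ｝ u) (｛ b ｝ w)))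
                            (weight-｛｝ a (λ _ → [ ｛ b ｝ w ]· v))

  cut-+ : ∀ {m n} (c d : Fin m → Fin n → ℤ) X Y → cut (λ u w → c u w + d u w) X Y ≡ cut c X Y + cut d X Y
  cut-+ c d X Y = trans (sum-cong-≗ (λ u → sum-cong-≗ (λ w → pointwise (X u ∧ not (Y w)))))
                        (∑∑-distrib-+ (λ u w → [ X u ∧ not (Y w) ]· c u w) (λ u w → [ X u ∧ not (Y w) ]· d u w))
    where
    pointwise : ∀ p {x y} → [ p ]· (x + y) ≡ [ p ]· x + [ p ]· y
    pointwise true  = refl
    pointwise false = refl

  cut-arc : ∀ {m n} (a : Fin m) (b : Fin n) v X Y → cut (arc a b v) X Y ≡ [ X a ∧ not (Y b) ]· v
  cut-arc {m} {n} a b v X Y = begin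
    ∑[ u < m ] ∑[ w < n ] [ X u ∧ not (Y w) ]· [ ｛ a ｝ u ∧ ｛ b ｝ w ]· v
      ≡⟨ sum-cong-≗ (λ u → sum-cong-≗ (λ w → reorder (X u ∧ not (Y w)) (｛ a ｝ u) (｛ b ｝ w))) ⟩
    ∑[ u < m ] ∑[ w < n ] [ ｛ a ｝ u ]· [ ｛ b ｝ w ]· [ X u ∧ not (Y w) ]· v
      ≡⟨ sum-cong-≗ (λ u → ∑-[]· (｛ a ｝ u) (λ w → [ ｛ b ｝ w ]· [ X u ∧ not (Y w) ]· v)) ⟩
    weight ｛ a ｝ (λ u → weight ｛ b ｝ (λ w → [ X u ∧ not (Y w) ]· v))
      ≡⟨ weight-｛｝ a _ ⟩
    weight ｛ b ｝ (λ w → [ X a ∧ not (Y w) ]· v)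
      ≡⟨ weight-｛｝ b _ ⟩
    [ X a ∧ not (Y b) ]· v ∎
    where
    open ≡-Reasoning
    reorder : ∀ p q r → [ p ]· [ q ∧ r ]· v ≡ [ q ]· [ r ]· [ p ]· v
    reorder p q r = begin
      [ p ]· [ q ∧ r ]· v   ≡⟨ []·-comm p (q ∧ r) ⟩
      [ q ∧ r ]· [ p ]· v   ≡⟨ []·-∧ q r ⟩
      [ q ]· [ r ]· [ p ]· v ∎

  cut-submodular : ∀ {m n} (c : Fin m → Fin n → ℤ) → (∀ u w → 0ℤ ≤ c u w) → ∀ X₁ X₂ Y₁ Y₂ →
                   cut c (X₁ ∪ X₂) (Y₁ ∪ Y₂) + cut c (X₁ ∩ X₂) (Y₁ ∩ Y₂) ≤ cut c X₁ Y₁ + cut c X₂ Y₂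
  cut-submodular c c≥0 X₁ X₂ Y₁ Y₂ =
    subst₂ _≤_ (∑∑-distrib-+ (term (X₁ ∪ X₂) (Y₁ ∪ Y₂)) (term (X₁ ∩ X₂) (Y₁ ∩ Y₂)))
               (∑∑-distrib-+ (term X₁ Y₁) (term X₂ Y₂))
               (∑-mono λ u → ∑-mono λ w →
                 []·-count ((X₁ u ∨ X₂ u) ∧ not (Y₁ w ∨ Y₂ w)) ((X₁ u ∧ X₂ u) ∧ not (Y₁ w ∧ Y₂ w))
                           (X₁ u ∧ not (Y₁ w)) (X₂ u ∧ not (Y₂ w))
                           (c≥0 u w) (count (X₁ u) (X₂ u) (Y₁ w) (Y₂ w)))
    where
    term : (Fin _ → Bool) → (Fin _ → Bool) → Fin _ → Fin _ → ℤ
    term X Y u w = [ X u ∧ not (Y w) ]· c u w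
    counted : ∀ {i j : ℤ} {_ : T (i ℤ.≤ᵇ j)} → i ≤ j
    counted {_} {_} {i≤j} = ℤₚ.≤ᵇ⇒≤ i≤j
    count : ∀ x₁ x₂ y₁ y₂ → [ (x₁ ∨ x₂) ∧ not (y₁ ∨ y₂) ]· 1ℤ + [ (x₁ ∧ x₂) ∧ not (y₁ ∧ y₂) ]· 1ℤ
                            ≤ [ x₁ ∧ not y₁ ]· 1ℤ + [ x₂ ∧ not y₂ ]· 1ℤ
    count true  true  true  true  = counted
    count true  true  true  false = counted
    count true  true  false true  = counted
    count true  true  false false = counted
    count true  false true  _     = counted
    count true  false false true  = counted
    count true  false false false = counted
    count false true  true  true  = counted
    count false true  true  false = counted
    count false true  false true  = counted
    count false true  false false = counted
    count false false _     _     = counted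

  slack : ∀ {m n} → (Fin m → Fin n → ℤ) → (Fin m → ℤ) → (Fin n → ℤ) → (Fin m → Bool) → (Fin n → Bool) → ℤ
  slack c R C X Y = weight X R - weight Y C - cut c X Y

  slack-cong : ∀ {m n} (c : Fin m → Fin n → ℤ) R C {X X′ Y Y′} → X ≗ X′ → Y ≗ Y′ →
               slack c R C X Y ≡ slack c R C X′ Y′
  slack-cong c R C X≗X′ Y≗Y′ =
    cong₂ _-_ (cong₂ _-_ (weight-cong X≗X′ R) (weight-cong Y≗Y′ C)) (cut-cong c X≗X′ Y≗Y′)

  slack-supermodular : ∀ {m n} (c : Fin m → Fin n → ℤ) R C → (∀ u w → 0ℤ ≤ c u w) → ∀ X₁ X₂ Y₁ Y₂ →
    slack c R C X₁ Y₁ + slack c R C X₂ Y₂ ≤ slack c R C (X₁ ∪ X₂) (Y₁ ∪ Y₂) + slack c R C (X₁ ∩ X₂) (Y₁ ∩ Y₂)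
  slack-supermodular c R C c≥0 X₁ X₂ Y₁ Y₂ =
    combine (weight X₁ R) (weight X₂ R) (weight (X₁ ∪ X₂) R) (weight (X₁ ∩ X₂) R)
            (weight Y₁ C) (weight Y₂ C) (weight (Y₁ ∪ Y₂) C) (weight (Y₁ ∩ Y₂) C)
            (cut c X₁ Y₁) (cut c X₂ Y₂) (cut c (X₁ ∪ X₂) (Y₁ ∪ Y₂)) (cut c (X₁ ∩ X₂) (Y₁ ∩ Y₂))
            (weight-modular X₁ X₂ R) (weight-modular Y₁ Y₂ C) (cut-submodular c c≥0 X₁ X₂ Y₁ Y₂)
    where
    combine : ∀ a₁ a₂ a₃ a₄ b₁ b₂ b₃ b₄ k₁ k₂ k₃ k₄ →
              a₁ + a₂ ≡ a₃ + a₄ → b₁ + b₂ ≡ b₃ + b₄ → k₃ + k₄ ≤ k₁ + k₂ →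
              (a₁ - b₁ - k₁) + (a₂ - b₂ - k₂) ≤ (a₃ - b₃ - k₃) + (a₄ - b₄ - k₄)
    combine a₁ a₂ a₃ a₄ b₁ b₂ b₃ b₄ k₁ k₂ k₃ k₄ a b k = begin
      (a₁ - b₁ - k₁) + (a₂ - b₂ - k₂)       ≡⟨ regroup a₁ a₂ b₁ b₂ k₁ k₂ ⟩
      (a₁ + a₂) - (b₁ + b₂) - (k₁ + k₂)     ≡⟨ cong₂ (λ s t → s - t - (k₁ + k₂)) a b ⟩
      (a₃ + a₄) - (b₃ + b₄) - (k₁ + k₂)     ≤⟨ ℤₚ.+-monoʳ-≤ ((a₃ + a₄) - (b₃ + b₄)) (ℤₚ.neg-mono-≤ k) ⟩
      (a₃ + a₄) - (b₃ + b₄) - (k₃ + k₄)     ≡⟨ regroup a₃ a₄ b₃ b₄ k₃ k₄ ⟨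
      (a₃ - b₃ - k₃) + (a₄ - b₄ - k₄)       ∎
      where
      open ℤₚ.≤-Reasoning
      regroup : ∀ a₁ a₂ b₁ b₂ k₁ k₂ → (a₁ - b₁ - k₁) + (a₂ - b₂ - k₂) ≡ (a₁ + a₂) - (b₁ + b₂) - (k₁ + k₂)
      regroup = solve-∀

  maxOver : ∀ n → ((Fin n → Bool) → ℤ) → ℤ
  maxOver ℕ.zero    F = F (λ ())
  maxOver (ℕ.suc n) F = maxOver n (λ X → F (true Vector.∷ X)) ⊔ maxOver n (λ X → F (false Vector.∷ X))

  maxOver-cong : ∀ n {F G : (Fin n → Bool) → ℤ} → (∀ X → F X ≡ G X) → maxOver n F ≡ maxOver n G
  maxOver-cong ℕ.zero    F≡G = F≡G _
  maxOver-cong (ℕ.suc n) F≡G = cong₂ _⊔_ (maxOver-cong n (F≡G ∘ (true Vector.∷_)))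
                                         (maxOver-cong n (F≡G ∘ (false Vector.∷_)))

  maxOver-upper : ∀ n (F : (Fin n → Bool) → ℤ) → (∀ {X Y} → X ≗ Y → F X ≡ F Y) → ∀ X → F X ≤ maxOver n F
  maxOver-upper ℕ.zero    F F-cong X = ℤₚ.≤-reflexive (F-cong (λ ()))
  maxOver-upper (ℕ.suc n) F F-cong X = ℤₚ.≤-trans (ℤₚ.≤-reflexive (F-cong head∷tail)) (cons (X zero))
    where
    head∷tail : X ≗ X zero Vector.∷ (X ∘ suc)
    head∷tail zero    = refl
    head∷tail (suc i) = refl
    tail-cong : ∀ b {Y Z} → Y ≗ Z → F (b Vector.∷ Y) ≡ F (b Vector.∷ Z)
    tail-cong b Y≗Z = F-cong λ { zero → refl ; (suc i) → Y≗Z i }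
    cons : ∀ b → F (b Vector.∷ (X ∘ suc)) ≤ maxOver (ℕ.suc n) F
    cons true  = ℤₚ.≤-trans (maxOver-upper n _ (tail-cong true) (X ∘ suc)) (ℤₚ.i≤i⊔j _ _)
    cons false = ℤₚ.≤-trans (maxOver-upper n _ (tail-cong false) (X ∘ suc)) (ℤₚ.i≤j⊔i _ _)

  maxOver-least : ∀ n (F : (Fin n → Bool) → ℤ) B → (∀ X → F X ≤ B) → maxOver n F ≤ B
  maxOver-least ℕ.zero    F B F≤B = F≤B _
  maxOver-least (ℕ.suc n) F B F≤B = ℤₚ.⊔-lub (maxOver-least n _ B (F≤B ∘ (true Vector.∷_)))
                                             (maxOver-least n _ B (F≤B ∘ (false Vector.∷_)))

  module RemoveArc {m n} (c : Fin m → Fin n → ℤ) (R : Fin m → ℤ) (C : Fin n → ℤ) (a : Fin m) (b : Fin n)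
                   (c≥0 : ∀ u w → 0ℤ ≤ c u w) (gale : GaleCondition c R C) where

    κ : ℤ
    κ = c a b

    c′ : Fin m → Fin n → ℤ
    c′ u w = [ not (does (u ≟ a) ∧ does (w ≟ b)) ]· c u w

    c′≥0 : ∀ u w → 0ℤ ≤ c′ u w
    c′≥0 u w = []·-nonneg (not (does (u ≟ a) ∧ does (w ≟ b))) (c≥0 u w)

    c≡c′+arc : ∀ u w → c u w ≡ c′ u w + arc a b κ u w
    c≡c′+arc u w with u ≟ a | w ≟ b
    ... | yes refl | yes refl = sym (ℤₚ.+-identityˡ _)
    ... | yes _    | no _     = sym (ℤₚ.+-identityʳ _)
    ... | no _     | _        = sym (ℤₚ.+-identityʳ _)

    c′-support : ∀ {L} → (∀ u w → c u w ≡ 0ℤ ⊎ (u , w) ∈ (a , b) ∷ L) → ∀ u w → c′ u w ≡ 0ℤ ⊎ (u , w) ∈ L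
    c′-support supp u w with u ≟ a | w ≟ b | supp u w
    ... | yes _ | yes _ | _               = inj₁ refl
    ... | _     | _     | inj₁ c≡0        = inj₁ (trans (cong ([ _ ]·_) c≡0) ([]·-zero _))
    ... | _     | _     | inj₂ (there uw) = inj₂ uw
    ... | yes _ | no w≢b | inj₂ (here eq) = contradiction (cong proj₂ eq) w≢b
    ... | no u≢a | _    | inj₂ (here eq)  = contradiction (cong proj₁ eq) u≢a

    S : (Fin m → Bool) → (Fin n → Bool) → ℤ
    S = slack c′ R C

    S≤κ : ∀ X Y → S X Y ≤ [ X a ∧ not (Y b) ]· κ
    S≤κ X Y = i≤j+[k+t]⇒i-j-k≤t (subst (λ k → weight X R ≤ weight Y C + k) cut-split (gale X Y))
      where
      cut-split : cut c X Y ≡ cut c′ X Y + [ X a ∧ not (Y b) ]· κ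
      cut-split = trans (cut-congᶜ c≡c′+arc X Y)
                        (trans (cut-+ c′ (arc a b κ) X Y) (cong (cut c′ X Y +_) (cut-arc a b κ X Y)))
      i≤j+[k+t]⇒i-j-k≤t : ∀ {i j k t} → i ≤ j + (k + t) → i - j - k ≤ t
      i≤j+[k+t]⇒i-j-k≤t {i} {j} {k} {t} h = ≤-shift (- j - k) h (lhs i j k) (rhs j k t)
        where
        lhs : ∀ i j k → i + (- j - k) ≡ i - j - k
        lhs = solve-∀
        rhs : ∀ j k t → j + (k + t) + (- j - k) ≡ t
        rhs = solve-∀

    gain : (Fin m → Bool) → (Fin n → Bool) → ℤ
    gain X Y = [ X a ∧ not (Y b) ]· S X Y

    gain-cong : ∀ {X X′ Y Y′} → X ≗ X′ → Y ≗ Y′ → gain X Y ≡ gain X′ Y′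
    gain-cong X≗X′ Y≗Y′ = cong₂ (λ p s → [ p ]· s) (cong₂ (λ p q → p ∧ not q) (X≗X′ a) (Y≗Y′ b))
                                                   (slack-cong c′ R C X≗X′ Y≗Y′)

    load : ℤ
    load = maxOver m (λ X → maxOver n (gain X))

    gain≤load : ∀ X Y → gain X Y ≤ load
    gain≤load X Y = ℤₚ.≤-trans (maxOver-upper n (gain X) (gain-cong (λ _ → refl)) Y)
      (maxOver-upper m _ (λ X≗X′ → maxOver-cong n (λ Y → gain-cong X≗X′ (λ _ → refl))) X)

    load-least : ∀ B → (∀ X Y → gain X Y ≤ B) → load ≤ B
    load-least B gain≤B = maxOver-least m _ B (λ X → maxOver-least n _ B (gain≤B X))

    0≤load : 0ℤ ≤ load
    0≤load = gain≤load (λ _ → false) (λ _ → false)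

    load≤κ : load ≤ κ
    load≤κ = load-least κ gain≤κ
      where
      gain≤κ : ∀ X Y → gain X Y ≤ κ
      gain≤κ X Y with X a ∧ not (Y b) | S≤κ X Y
      ... | true  | S≤ = S≤
      ... | false | _  = c≥0 a b

    S≤0 : ∀ X Y → X a ∧ not (Y b) ≡ false → S X Y ≤ 0ℤ
    S≤0 X Y off = subst (λ p → S X Y ≤ [ p ]· κ) off (S≤κ X Y)

    load≤-S : ∀ X Y → X a ≡ false → Y b ≡ true → load ≤ - S X Y
    load≤-S X Y Xa Yb = load-least (- S X Y) gain≤-S
      where
      0≤-S : 0ℤ ≤ - S X Y
      0≤-S = ℤₚ.neg-mono-≤ (S≤0 X Y (cong (_∧ not (Y b)) Xa))
      gain≤-S : ∀ X₁ Y₁ → gain X₁ Y₁ ≤ - S X Y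
      gain≤-S X₁ Y₁ with X₁ a in X₁a | Y₁ b in Y₁b
      ... | false | _    = 0≤-S
      ... | true  | true = 0≤-S
      ... | true  | false = ≤-shift (- S X Y) (begin
        S X₁ Y₁ + S X Y                                  ≤⟨ slack-supermodular c′ R C c′≥0 X₁ X Y₁ Y ⟩
        S (X₁ ∪ X) (Y₁ ∪ Y) + S (X₁ ∩ X) (Y₁ ∩ Y)      ≤⟨ ℤₚ.+-mono-≤ (S≤0 _ _ off∪) (S≤0 _ _ off∩) ⟩
        0ℤ                                               ∎) (cancel (S X₁ Y₁) (S X Y)) (ℤₚ.+-identityˡ _)
        where
        open ℤₚ.≤-Reasoning
        off∪ : (X₁ a ∨ X a) ∧ not (Y₁ b ∨ Y b) ≡ false
        off∪ rewrite X₁a | Y₁b | Yb = refl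
        off∩ : (X₁ a ∧ X a) ∧ not (Y₁ b ∧ Y b) ≡ false
        off∩ rewrite X₁a | Xa = refl
        cancel : ∀ s t → s + t + - t ≡ s
        cancel = solve-∀

    S≤load : ∀ X Y → S X Y ≤ [ X a ]· load - [ Y b ]· load
    S≤load X Y with X a in Xa | Y b in Yb | S≤κ X Y | gain≤load X Y
    ... | true  | true  | S≤0ℤ | _    = subst (S X Y ≤_) (sym (ℤₚ.+-inverseʳ load)) S≤0ℤ
    ... | true  | false | _    | S≤ℓ = subst (S X Y ≤_) (sym (ℤₚ.+-identityʳ load)) S≤ℓ
    ... | false | false | S≤0ℤ | _    = S≤0ℤ
    ... | false | true  | _    | _    = subst₂ _≤_ (ℤₚ.neg-involutive (S X Y)) (sym (ℤₚ.+-identityˡ (- load)))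
                                               (ℤₚ.neg-mono-≤ (load≤-S X Y Xa Yb))

    R′ : Fin m → ℤ
    R′ u = R u - [ ｛ a ｝ u ]· load

    C′ : Fin n → ℤ
    C′ w = C w - [ ｛ b ｝ w ]· load

    weight-R′ : ∀ X → weight X R′ ≡ weight X R - [ X a ]· load
    weight-R′ X = trans (weight-difference X R _) (cong (λ t → weight X R - t) (weight-δ X a load))

    weight-C′ : ∀ Y → weight Y C′ ≡ weight Y C - [ Y b ]· load
    weight-C′ Y = trans (weight-difference Y C _) (cong (λ t → weight Y C - t) (weight-δ Y b load))

    reduced-total : sum R ≡ sum C → sum R′ ≡ sum C′
    reduced-total total = trans (weight-R′ (λ _ → true))
                                (trans (cong (_- load) total) (sym (weight-C′ (λ _ → true))))

    reduced-gale : GaleCondition c′ R′ C′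
    reduced-gale X Y = subst₂ (λ r s → r ≤ s + cut c′ X Y) (sym (weight-R′ X)) (sym (weight-C′ Y))
                              (i-j-k≤s-t⇒i-s≤[j-t]+k (weight X R) (weight Y C) (cut c′ X Y) _ _ (S≤load X Y))
      where
      i-j-k≤s-t⇒i-s≤[j-t]+k : ∀ i j k s t → i - j - k ≤ s - t → i - s ≤ (j - t) + k
      i-j-k≤s-t⇒i-s≤[j-t]+k i j k s t h = ≤-shift (j + k - s) h (lhs i j k s) (rhs j k s t)
        where
        lhs : ∀ i j k s → i - j - k + (j + k - s) ≡ i - s
        lhs = solve-∀
        rhs : ∀ j k s t → s - t + (j + k - s) ≡ j - t + k
        rhs = solve-∀

    extend : ∀ {x} → IsFlow c′ R′ C′ x → IsFlow c R C (λ u w → x u w + arc a b load u w)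
    extend {x} flow = record
      { nonneg  = λ u w → ℤₚ.+-mono-≤ (nonneg u w) ([]·-nonneg (｛ a ｝ u ∧ ｛ b ｝ w) 0≤load)
      ; bounded = λ u w → subst (x u w + arc a b load u w ≤_) (sym (c≡c′+arc u w))
                                (ℤₚ.+-mono-≤ (bounded u w) ([]·-mono (｛ a ｝ u ∧ ｛ b ｝ w) load≤κ))
      ; rowSum  = λ u → trans (∑-distrib-+ (x u) (λ w → arc a b load u w))
                              (trans (cong₂ _+_ (rowSum u) (∑-arc-row a b load u)) (restore (R u) _))
      ; colSum  = λ w → trans (∑-distrib-+ (λ u → x u w) (λ u → arc a b load u w))
                              (trans (cong₂ _+_ (colSum w) (∑-arc-col a b load w)) (restore (C w) _))
      }
      where
      open IsFlow flow
      restore : ∀ r t → r - t + t ≡ r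
      restore = solve-∀

  zero-flow : ∀ {m n} (c : Fin m → Fin n → ℤ) R C → (∀ u w → c u w ≡ 0ℤ) → sum R ≡ sum C →
              GaleCondition c R C → IsFlow c R C (λ _ _ → 0ℤ)
  zero-flow {m} {n} c R C c≡0 total gale = record
    { nonneg  = λ _ _ → ℤₚ.≤-refl
    ; bounded = λ u w → ℤₚ.≤-reflexive (sym (c≡0 u w))
    ; rowSum  = λ u → trans (sum-replicate-zero n) (sym (R≡0 u))
    ; colSum  = λ w → trans (sum-replicate-zero m) (sym (C≡0 w))
    }
    where
    cut≡0 : ∀ X Y → cut c X Y ≡ 0ℤ
    cut≡0 X Y = trans (cut-congᶜ c≡0 X Y)
      (trans (sum-cong-≗ (λ u → trans (sum-cong-≗ (λ w → []·-zero (X u ∧ not (Y w)))) (sum-replicate-zero n)))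
             (sum-replicate-zero m))

    weight≤weight : ∀ X Y → weight X R ≤ weight Y C
    weight≤weight X Y = subst (weight X R ≤_) (trans (cong (weight Y C +_) (cut≡0 X Y)) (ℤₚ.+-identityʳ _))
                              (gale X Y)

    cancel : ∀ r w → r + w - w ≡ r
    cancel = solve-∀
    0≤r : ∀ {r w s} → r + w ≡ s → w ≤ s → 0ℤ ≤ r
    0≤r {r} {w} refl w≤s = subst (0ℤ ≤_) (cancel r w) (ℤₚ.i≤j⇒0≤j-i w≤s)
    r≤0 : ∀ {r w s} → r + w ≡ s → s ≤ w → r ≤ 0ℤ
    r≤0 {r} {w} refl s≤w = subst (_≤ 0ℤ) (cancel r w) (ℤₚ.i≤j⇒i-j≤0 s≤w)

    R≡0 : ∀ u → R u ≡ 0ℤ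
    R≡0 u = ℤₚ.≤-antisym
      (subst₂ _≤_ (weight-｛｝ u R) (sum-replicate-zero n) (weight≤weight ｛ u ｝ (λ _ → false)))
      (0≤r (trans (cong (_+ weight (not ∘ ｛ u ｝) R) (sym (weight-｛｝ u R)))
                  (trans (weight-∁ ｛ u ｝ R) total))
           (weight≤weight (not ∘ ｛ u ｝) (λ _ → true)))

    C≡0 : ∀ w → C w ≡ 0ℤ
    C≡0 w = ℤₚ.≤-antisym
      (r≤0 (trans (cong (_+ weight (not ∘ ｛ w ｝) C) (sym (weight-｛｝ w C)))
                  (trans (weight-∁ ｛ w ｝ C) (sym total)))
           (weight≤weight (λ _ → true) (not ∘ ｛ w ｝)))
      (subst₂ _≤_ (sum-replicate-zero m) (weight-｛｝ w C) (weight≤weight (λ _ → false) ｛ w ｝))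

  supply-demand-on : ∀ {m n} (L : List (Fin m × Fin n)) (c : Fin m → Fin n → ℤ) R C →
    (∀ u w → 0ℤ ≤ c u w) → (∀ u w → c u w ≡ 0ℤ ⊎ (u , w) ∈ L) →
    sum R ≡ sum C → GaleCondition c R C → Σ (Fin m → Fin n → ℤ) (IsFlow c R C)
  supply-demand-on [] c R C c≥0 supp total gale = _ , zero-flow c R C c≡0 total gale
    where
    c≡0 : ∀ u w → c u w ≡ 0ℤ
    c≡0 u w with supp u w
    ... | inj₁ c≡0 = c≡0
  supply-demand-on ((a , b) ∷ L) c R C c≥0 supp total gale =
    let open RemoveArc c R C a b c≥0 gale
        (_ , flow) = supply-demand-on L c′ R′ C′ c′≥0 (c′-support supp) (reduced-total total) reduced-gale
    in _ , extend flow

  supply-demand : ∀ {m n} (c : Fin m → Fin n → ℤ) R C → (∀ u w → 0ℤ ≤ c u w) →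
    sum R ≡ sum C → GaleCondition c R C → Σ (Fin m → Fin n → ℤ) (IsFlow c R C)
  supply-demand {m} {n} c R C c≥0 = supply-demand-on (cartesianProduct (allFin m) (allFin n)) c R C c≥0
    (λ u w → inj₂ (∈-cartesianProduct⁺ (∈-allFin u) (∈-allFin w)))

module DegreeSequence where
  open import Data.Nat using (_+_; _*_; _∸_; _≤_; _<_; _⊓_; _<ᵇ_; z≤n; s≤s)
  open import Data.Nat.Tactic.RingSolver using (solve-∀)
  open import Data.Fin using (toℕ)
  open import Data.Fin.Properties using (any?)
  open ℕΣ

  card : ∀ {n} → (Fin n → Bool) → ℕ
  card X = weight X (λ _ → 1)

  first : ∀ {n} → ℕ → Fin n → Bool
  first k i = toℕ i <ᵇ k

  top : ∀ {n} → (Fin n → ℕ) → ℕ → ℕ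
  top h k = weight (first k) h

  top-zero : ∀ {n} (h : Fin n → ℕ) → top h 0 ≡ 0
  top-zero {n} h = sum-replicate-zero n

  top-step : ∀ {n} (h : Fin n → ℕ) {M} → (∀ i → h i ≤ M) → ∀ k → top h (ℕ.suc k) ≤ M + top h k
  top-step {ℕ.zero}  h h≤M k = z≤n
  top-step {ℕ.suc n} h {M} h≤M ℕ.zero rewrite top-zero (h ∘ suc) =
    ℕₚ.+-monoˡ-≤ 0 (h≤M zero)
  top-step {ℕ.suc n} h {M} h≤M (ℕ.suc k) = begin
    h zero + top (h ∘ suc) (ℕ.suc k)  ≤⟨ ℕₚ.+-monoʳ-≤ (h zero) (top-step (h ∘ suc) (h≤M ∘ suc) k) ⟩
    h zero + (M + top (h ∘ suc) k)    ≡⟨ ℕₚ.+-comm (h zero) _ ⟩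
    M + top (h ∘ suc) k + h zero      ≡⟨ ℕₚ.+-assoc M _ _ ⟩
    M + (top (h ∘ suc) k + h zero)    ≡⟨ cong (M +_) (ℕₚ.+-comm _ (h zero)) ⟩
    M + top h (ℕ.suc k)               ∎
    where open ℕₚ.≤-Reasoning

  NonIncreasing-tail : ∀ {n} {h : Fin (ℕ.suc n) → ℕ} → NonIncreasing h → NonIncreasing (h ∘ suc)
  NonIncreasing-tail h↓ i j i≤j = h↓ (suc i) (suc j) (s≤s i≤j)

  top-tail≤top : ∀ {n} {h : Fin (ℕ.suc n) → ℕ} → NonIncreasing h → ∀ k → top (h ∘ suc) k ≤ top h k
  top-tail≤top {h = h} h↓ ℕ.zero    = ℕₚ.≤-reflexive (trans (top-zero (h ∘ suc)) (sym (top-zero h)))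
  top-tail≤top {h = h} h↓ (ℕ.suc k) = top-step (h ∘ suc) (λ i → h↓ zero (suc i) z≤n) k

  weight≤top : ∀ {n} {h : Fin n → ℕ} → NonIncreasing h → ∀ X → weight X h ≤ top h (card X)
  weight≤top {ℕ.zero}  h↓ X = z≤n
  weight≤top {ℕ.suc n} {h} h↓ X with X zero
  ... | true  = ℕₚ.+-monoʳ-≤ (h zero) (weight≤top (NonIncreasing-tail h↓) (X ∘ suc))
  ... | false = ℕₚ.≤-trans (weight≤top (NonIncreasing-tail h↓) (X ∘ suc)) (top-tail≤top h↓ (card (X ∘ suc)))

  sumℕ≡sum : ∀ {n} (f : Fin n → ℕ) → sumℕ f ≡ sum f
  sumℕ≡sum {ℕ.zero}  f = refl
  sumℕ≡sum {ℕ.suc n} f = cong (f zero +_) (sumℕ≡sum (f ∘ suc))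

  headSum≡top : ∀ {n} (d : Fin n → ℕ) k → headSum d k ≡ top d k
  headSum≡top d k = trans (sumℕ≡sum (λ i → if ⌊ toℕ i ℕ.<? k ⌋ then d i else 0)) (sum-cong-≗ λ i →
    cong (λ b → if b then d i else 0) (isYes≗does (toℕ i ℕ.<? k)))

  tailMinSum≡weight : ∀ {n} (d : Fin n → ℕ) k → tailMinSum d k ≡ weight (not ∘ first k) (λ i → k ⊓ d i)
  tailMinSum≡weight d k = trans (sumℕ≡sum (λ i → if ⌊ toℕ i ℕ.<? k ⌋ then 0 else k ⊓ d i)) (sum-cong-≗ λ i →
    trans (cong (λ b → if b then 0 else k ⊓ d i) (isYes≗does (toℕ i ℕ.<? k))) (negated (toℕ i <ᵇ k)))
    where
    negated : ∀ b {x} → (if b then 0 else x) ≡ [ not b ]· x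
    negated true  = refl
    negated false = refl

  card≤ : ∀ {n} (X : Fin n → Bool) → card X ≤ n
  card≤ {ℕ.zero}  X = z≤n
  card≤ {ℕ.suc n} X with X zero
  ... | true  = s≤s (card≤ (X ∘ suc))
  ... | false = ℕₚ.m≤n⇒m≤1+n (card≤ (X ∘ suc))

  strict-for-subsets : ∀ {n} {d : Fin n → ℕ} → NonIncreasing d → StrictConditions d →
    ∀ A → 1 ≤ card A → weight A d < card A * (card A ∸ 1) + weight (not ∘ A) (λ i → card A ⊓ d i)
  strict-for-subsets {n} {d} d↓ conditions A 1≤a = ℕₚ.+-cancelʳ-≤ (weight A m) _ _ (begin
    ℕ.suc (weight A d + weight A m)            ≡⟨ cong ℕ.suc (weight-+ A d m) ⟨
    ℕ.suc (weight A (λ i → d i + m i))         ≤⟨ s≤s (weight≤top h↓ A) ⟩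
    ℕ.suc (top (λ i → d i + m i) a)            ≡⟨ cong ℕ.suc (weight-+ (first a) d m) ⟩
    ℕ.suc (top d a) + top m a                  ≤⟨ ℕₚ.+-monoˡ-≤ (top m a) strict-a ⟩
    a * (a ∸ 1) + rest + top m a               ≡⟨ ℕₚ.+-assoc (a * (a ∸ 1)) rest (top m a) ⟩
    a * (a ∸ 1) + (rest + top m a)             ≡⟨ cong (a * (a ∸ 1) +_) (ℕₚ.+-comm rest (top m a)) ⟩
    a * (a ∸ 1) + (top m a + rest)             ≡⟨ cong (a * (a ∸ 1) +_) (weight-∁ (first a) m) ⟩
    a * (a ∸ 1) + sum m                        ≡⟨ cong (a * (a ∸ 1) +_) (weight-∁ A m) ⟨
    a * (a ∸ 1) + (weight A m + weight (not ∘ A) m)  ≡⟨ regroup (a * (a ∸ 1)) (weight A m) _ ⟩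
    a * (a ∸ 1) + weight (not ∘ A) m + weight A m    ∎)
    where
    open ℕₚ.≤-Reasoning
    a : ℕ
    a = card A
    m : Fin n → ℕ
    m i = a ⊓ d i
    rest : ℕ
    rest = weight (not ∘ first a) m
    h↓ : NonIncreasing (λ i → d i + m i)
    h↓ i j i≤j = ℕₚ.+-mono-≤ (d↓ i j i≤j) (ℕₚ.⊓-monoʳ-≤ a (d↓ i j i≤j))
    regroup : ∀ x y z → x + (y + z) ≡ x + z + y
    regroup = solve-∀
    strict-a : ℕ.suc (top d a) ≤ a * (a ∸ 1) + rest
    strict-a = subst₂ (λ s t → ℕ.suc s ≤ a * (a ∸ 1) + t) (headSum≡top d a) (tailMinSum≡weight d a)
                      (conditions a 1≤a (card≤ A))

  offDiagonal : ∀ {n} → Fin n → Fin n → ℕ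
  offDiagonal u w = [ not (does (u ≟ w)) ]· 1

  cross : ∀ {n} → (Fin n → Bool) → (Fin n → Bool) → ℕ
  cross = cut offDiagonal

  others : ∀ {n} → (Fin n → Bool) → Fin n → ℕ
  others {n} X w = ∑[ u < n ] [ X u ]· offDiagonal u w

  others+self : ∀ {n} (X : Fin n → Bool) w → others X w + [ X w ]· 1 ≡ card X
  others+self {n} X w = begin
    others X w + [ X w ]· 1
      ≡⟨ cong (others X w +_) (weight-｛｝ w (λ u → [ X u ]· 1)) ⟨
    others X w + weight ｛ w ｝ (λ u → [ X u ]· 1)
      ≡⟨ ∑-distrib-+ (λ u → [ X u ]· offDiagonal u w) (λ u → [ ｛ w ｝ u ]· [ X u ]· 1) ⟨
    ∑[ u < n ] ([ X u ]· offDiagonal u w + [ ｛ w ｝ u ]· [ X u ]· 1)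
      ≡⟨ sum-cong-≗ (λ u → pointwise (X u) (｛ w ｝ u)) ⟩
    card X ∎
    where
    open ≡-Reasoning
    pointwise : ∀ x e → [ x ]· [ not e ]· 1 + [ e ]· [ x ]· 1 ≡ [ x ]· 1
    pointwise true  true  = refl
    pointwise true  false = refl
    pointwise false true  = refl
    pointwise false false = refl

  cross≡∑others : ∀ {n} (X Y : Fin n → Bool) → cross X Y ≡ ∑[ w < n ] [ not (Y w) ]· others X w
  cross≡∑others {n} X Y = trans (∑-comm (λ u w → [ X u ∧ not (Y w) ]· offDiagonal u w)) (sum-cong-≗ λ w →
    trans (sum-cong-≗ λ u → trans ([]·-∧ (X u) (not (Y w))) ([]·-comm (X u) (not (Y w))))
          (∑-[]· (not (Y w)) (λ u → [ X u ]· offDiagonal u w)))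

  weight-scaled : ∀ {n} (X : Fin n → Bool) c (f : Fin n → ℕ) → weight X (λ i → c * f i) ≡ c * weight X f
  weight-scaled X c f = trans (sum-cong-≗ (λ i → pointwise (X i)))
                              (sym (*-distribˡ-sum c (λ i → [ X i ]· f i)))
    where
    pointwise : ∀ p {x} → [ p ]· (c * x) ≡ c * [ p ]· x
    pointwise true  = refl
    pointwise false = sym (ℕₚ.*-zeroʳ c)

  weight-const : ∀ {n} (X : Fin n → Bool) c → weight X (λ _ → c) ≡ c * card X
  weight-const X c = trans (sum-cong-≗ (λ i → cong ([ X i ]·_) (sym (ℕₚ.*-identityʳ c))))
                           (weight-scaled X c (λ _ → 1))

  cut-scaled : ∀ {n} c (f : Fin n → Fin n → ℕ) X Y → cut (λ u w → c * f u w) X Y ≡ c * cut f X Y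
  cut-scaled c f X Y = trans (sum-cong-≗ (λ u → weight-scaled (λ w → X u ∧ not (Y w)) c (f u)))
                             (sym (*-distribˡ-sum c (λ u → weight (λ w → X u ∧ not (Y w)) (f u))))

  member≤card : ∀ {n} (X : Fin n → Bool) u → X u ≡ true → 1 ≤ card X
  member≤card X zero    Xu rewrite Xu = s≤s z≤n
  member≤card X (suc u) Xu = ℕₚ.≤-trans (member≤card (X ∘ suc) u Xu) (ℕₚ.m≤n+m _ ([ X zero ]· 1))

  card-∖-∩ : ∀ {n} (X Y : Fin n → Bool) → card X ≡ card (X ∖ Y) + card (X ∩ Y)
  card-∖-∩ X Y = trans (sum-cong-≗ (λ w → split (X w) (Y w)))
                       (∑-distrib-+ (λ w → [ (X ∖ Y) w ]· 1) (λ w → [ (X ∩ Y) w ]· 1))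
    where
    split : ∀ x y → [ x ]· 1 ≡ [ x ∧ not y ]· 1 + [ x ∧ y ]· 1
    split true  true  = refl
    split true  false = refl
    split false _     = refl

  cross-termwise : ∀ x y dw o a k → a ≤ k → o + [ x ]· 1 ≡ k →
    [ x ]· dw + [ not (x ∧ not y) ]· (a ⊓ dw) + [ x ∧ not y ]· (k ∸ 1)
      ≤ [ y ]· dw + [ not y ]· o + [ x ∧ not y ]· dw + [ x ∧ y ]· a
  cross-termwise true  true  dw o a k _ _ =
    subst₂ _≤_ (sym (ℕₚ.+-identityʳ _)) (pad dw a) (ℕₚ.+-monoʳ-≤ dw (ℕₚ.m⊓n≤m a dw))
    where
    pad : ∀ p q → p + q ≡ p + 0 + 0 + q
    pad = solve-∀
  cross-termwise true  false dw o a k _ o+1≡k = ℕₚ.≤-reflexive (begin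
    dw + 0 + (k ∸ 1)     ≡⟨ cong (λ t → dw + 0 + (t ∸ 1)) o+1≡k ⟨
    dw + 0 + (o + 1 ∸ 1) ≡⟨ cong (dw + 0 +_) (ℕₚ.m+n∸n≡m o 1) ⟩
    dw + 0 + o           ≡⟨ swap dw o ⟩
    o + dw + 0           ∎)
    where
    open ≡-Reasoning
    swap : ∀ p q → p + 0 + q ≡ q + p + 0
    swap = solve-∀
  cross-termwise false true  dw o a k _ _ =
    subst₂ _≤_ (sym (ℕₚ.+-identityʳ _)) (pad dw) (ℕₚ.m⊓n≤n a dw)
    where
    pad : ∀ p → p ≡ p + 0 + 0 + 0
    pad = solve-∀
  cross-termwise false false dw o a k a≤k o+0≡k =
    subst₂ _≤_ (sym (ℕₚ.+-identityʳ _)) (pad o)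
      (ℕₚ.≤-trans (ℕₚ.m⊓n≤m a dw) (subst (a ≤_) (trans (sym o+0≡k) (ℕₚ.+-identityʳ o)) a≤k))
    where
    pad : ∀ p → p ≡ p + 0 + 0
    pad = solve-∀

  cross-lower-bound : ∀ {n} (d : Fin n → ℕ) (X Y : Fin n → Bool) →
    weight X d + weight (not ∘ (X ∖ Y)) (λ w → card (X ∖ Y) ⊓ d w) + (card X ∸ 1) * card (X ∖ Y)
      ≤ weight Y d + cross X Y + weight (X ∖ Y) d + card (X ∖ Y) * card (X ∩ Y)
  cross-lower-bound {n} d X Y = subst₂ _≤_ lhs rhs (∑-mono λ w →
    cross-termwise (X w) (Y w) (d w) (others X w) a k a≤k (others+self X w))
    where
    open ≡-Reasoning
    a k : ℕ
    a = card (X ∖ Y)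
    k = card X
    a≤k : a ≤ k
    a≤k = subst (a ≤_) (sym (card-∖-∩ X Y)) (ℕₚ.m≤m+n a (card (X ∩ Y)))
    lhs : ∑[ w < n ] ([ X w ]· d w + [ not ((X ∖ Y) w) ]· (a ⊓ d w) + [ (X ∖ Y) w ]· (k ∸ 1))
          ≡ weight X d + weight (not ∘ (X ∖ Y)) (λ w → a ⊓ d w) + (k ∸ 1) * a
    lhs = begin
      _ ≡⟨ ∑-distrib-+ (λ w → [ X w ]· d w + [ not ((X ∖ Y) w) ]· (a ⊓ d w)) (λ w → [ (X ∖ Y) w ]· (k ∸ 1)) ⟩
      _ ≡⟨ cong₂ _+_ (∑-distrib-+ (λ w → [ X w ]· d w) (λ w → [ not ((X ∖ Y) w) ]· (a ⊓ d w)))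
                     (weight-const (X ∖ Y) (k ∸ 1)) ⟩
      _ ∎
    rhs : ∑[ w < n ] ([ Y w ]· d w + [ not (Y w) ]· others X w + [ (X ∖ Y) w ]· d w + [ (X ∩ Y) w ]· a)
          ≡ weight Y d + cross X Y + weight (X ∖ Y) d + a * card (X ∩ Y)
    rhs = begin
      _ ≡⟨ ∑-distrib-+ (λ w → [ Y w ]· d w + [ not (Y w) ]· others X w + [ (X ∖ Y) w ]· d w)
                       (λ w → [ (X ∩ Y) w ]· a) ⟩
      _ ≡⟨ cong₂ _+_ (∑-distrib-+ (λ w → [ Y w ]· d w + [ not (Y w) ]· others X w) (λ w → [ (X ∖ Y) w ]· d w))
                     (weight-const (X ∩ Y) a) ⟩
      _ ≡⟨ cong (λ t → t + weight (X ∖ Y) d + a * card (X ∩ Y))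
                (trans (∑-distrib-+ (λ w → [ Y w ]· d w) (λ w → [ not (Y w) ]· others X w))
                       (cong (weight Y d +_) (sym (cross≡∑others X Y)))) ⟩
      _ ∎

  cancel-strict : ∀ a k z wX wY N wA co → 1 ≤ a → k ≡ a + z →
    wX + co + (k ∸ 1) * a ≤ wY + N + wA + a * z → wA < a * (a ∸ 1) + co → wX < wY + N
  cancel-strict (ℕ.suc a) _ z wX wY N wA co _ refl ≤₁ <₂ =
    ℕₚ.+-cancelʳ-≤ (co + wA + ℕ.suc a * a + ℕ.suc a * z) (ℕ.suc wX) (wY + N)
      (subst₂ _≤_ (lhs wX co a z wA) (rhs wY N wA a z co) (ℕₚ.+-mono-≤ ≤₁ <₂))
    where
    lhs : ∀ wX co a z wA → wX + co + (a + z) * ℕ.suc a + ℕ.suc wA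
                            ≡ ℕ.suc wX + (co + wA + ℕ.suc a * a + ℕ.suc a * z)
    lhs = solve-∀
    rhs : ∀ wY N wA a z co → wY + N + wA + ℕ.suc a * z + (ℕ.suc a * a + co)
                             ≡ wY + N + (co + wA + ℕ.suc a * a + ℕ.suc a * z)
    rhs = solve-∀

  weight<weight+cross : ∀ {n} {d : Fin n → ℕ} → NonIncreasing d → StrictConditions d →
    ∀ X Y u → X u ≡ true → Y u ≡ false → weight X d < weight Y d + cross X Y
  weight<weight+cross {n} {d} d↓ conditions X Y u Xu Yu =
    cancel-strict (card (X ∖ Y)) (card X) (card (X ∩ Y)) (weight X d) (weight Y d) (cross X Y)
                  (weight (X ∖ Y) d) (weight (not ∘ (X ∖ Y)) (λ w → card (X ∖ Y) ⊓ d w)) 1≤a (card-∖-∩ X Y)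
                  (cross-lower-bound d X Y) (strict-for-subsets d↓ conditions (X ∖ Y) 1≤a)
    where
    1≤a : 1 ≤ card (X ∖ Y)
    1≤a = member≤card (X ∖ Y) u (cong₂ (λ p q → p ∧ not q) Xu Yu)

  weight<weight-of-⊂ : ∀ {n} {d : Fin n → ℕ} → (∀ i → 0 < d i) → ∀ X Y →
    (∀ u → X u ≡ true → Y u ≡ true) → ∀ w → Y w ≡ true → X w ≡ false → weight X d < weight Y d
  weight<weight-of-⊂ {n} {d} d>0 X Y X⊆Y w Yw Xw = begin
    ℕ.suc (weight X d)                    ≡⟨ ℕₚ.+-comm 1 (weight X d) ⟩
    weight X d + 1                        ≤⟨ ℕₚ.+-monoʳ-≤ (weight X d) (d>0 w) ⟩
    weight X d + d w                      ≡⟨ cong (weight X d +_) (weight-｛｝ w d) ⟨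
    weight X d + weight ｛ w ｝ d          ≡⟨ ∑-distrib-+ (λ u → [ X u ]· d u) (λ u → [ ｛ w ｝ u ]· d u) ⟨
    ∑[ u < n ] ([ X u ]· d u + [ ｛ w ｝ u ]· d u)  ≤⟨ ∑-mono pointwise ⟩
    weight Y d                            ∎
    where
    open ℕₚ.≤-Reasoning
    pointwise : ∀ u → [ X u ]· d u + [ ｛ w ｝ u ]· d u ≤ [ Y u ]· d u
    pointwise u with u ≟ w
    ... | yes refl rewrite Xw | Yw = ℕₚ.≤-refl
    ... | no _ with X u in Xu
    ...   | true  rewrite X⊆Y u Xu = ℕₚ.≤-reflexive (ℕₚ.+-identityʳ _)
    ...   | false = z≤n

  ⊈⊎⊆ : ∀ {n} (X Y : Fin n → Bool) →
        (Σ (Fin n) λ u → X u ≡ true × Y u ≡ false) ⊎ (∀ u → X u ≡ true → Y u ≡ true)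
  ⊈⊎⊆ X Y with any? (λ u → X u ∧ not (Y u) Bool.≟ true)
  ... | yes (u , escapes) = inj₁ (u , outside (X u) (Y u) escapes)
    where
    outside : ∀ x y → x ∧ not y ≡ true → x ≡ true × y ≡ false
    outside true false refl = refl , refl
  ... | no ∄ = inj₂ λ u Xu → inside (X u) (Y u) Xu (λ escapes → ∄ (u , escapes))
    where
    inside : ∀ x y → x ≡ true → (x ∧ not y ≡ true → ⊥) → y ≡ true
    inside true true  _ _         = refl
    inside true false _ ∄-escape = contradiction refl ∄-escape

  weight<weight+cross-unless-≗ : ∀ {n} {d : Fin n → ℕ} → (∀ i → 0 < d i) → NonIncreasing d →
    StrictConditions d → ∀ X Y → X ≗ Y ⊎ weight X d < weight Y d + cross X Y
  weight<weight+cross-unless-≗ d>0 d↓ conditions X Y with ⊈⊎⊆ X Y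
  ... | inj₁ (u , Xu , Yu) = inj₂ (weight<weight+cross d↓ conditions X Y u Xu Yu)
  ... | inj₂ X⊆Y with ⊈⊎⊆ Y X
  ...   | inj₁ (w , Yw , Xw) = inj₂ (ℕₚ.≤-trans (weight<weight-of-⊂ d>0 X Y X⊆Y w Yw Xw) (ℕₚ.m≤m+n _ _))
  ...   | inj₂ Y⊆X = inj₁ λ u → antisym (X u) (Y u) (X⊆Y u) (Y⊆X u)
    where
    antisym : ∀ x y → (x ≡ true → y ≡ true) → (y ≡ true → x ≡ true) → x ≡ y
    antisym true  _     x⇒y _   = sym (x⇒y refl)
    antisym false true  _   y⇒x = y⇒x refl
    antisym false false _   _   = refl

  card-full : ∀ {n} → card {n} (λ _ → true) ≡ n
  card-full {ℕ.zero}  = refl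
  card-full {ℕ.suc n} = cong ℕ.suc card-full

  card-∁-｛｝ : ∀ {n} (k : Fin n) → card (not ∘ ｛ k ｝) ≡ n ∸ 1
  card-∁-｛｝ {n} k = cong (_∸ 1) (begin
    1 + card (not ∘ ｛ k ｝)                ≡⟨ cong (_+ card (not ∘ ｛ k ｝)) (weight-｛｝ k (λ _ → 1)) ⟨
    card ｛ k ｝ + card (not ∘ ｛ k ｝)      ≡⟨ weight-∁ ｛ k ｝ (λ _ → 1) ⟩
    card {n} (λ _ → true)                  ≡⟨ card-full ⟩
    n                                      ∎)
    where open ≡-Reasoning

  cross≤ : ∀ {n} (X Y : Fin n → Bool) → cross X Y ≤ n * n
  cross≤ {n} X Y =
    ℕₚ.≤-trans (∑-mono λ u → ℕₚ.≤-trans (∑-mono λ w → ≤1 (X u ∧ not (Y w)) (not (does (u ≟ w))))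
                                        (ℕₚ.≤-reflexive (card-full {n})))
               (ℕₚ.≤-reflexive (trans (weight-const {n} (λ _ → true) n) (cong (n *_) (card-full {n}))))
    where
    ≤1 : ∀ p q → [ p ]· [ q ]· 1 ≤ 1
    ≤1 true  true  = ℕₚ.≤-refl
    ≤1 true  false = z≤n
    ≤1 false _     = z≤n

  gale-inequality : ∀ {n} {d : Fin n → ℕ} → (∀ i → 0 < d i) → NonIncreasing d → StrictConditions d →
    ∀ P → 3 * (n * n) ≤ P → ∀ X Y →
    (2 + P) * weight X d + (n ∸ 1) * card Y ≤ (2 + P) * weight Y d + (n ∸ 1) * card X + P * cross X Y
  gale-inequality {n} {d} d>0 d↓ conditions P 3n²≤P X Y
    with weight<weight+cross-unless-≗ d>0 d↓ conditions X Y
  ... | inj₁ X≗Y rewrite weight-cong X≗Y d | weight-cong X≗Y (λ _ → 1) = ℕₚ.m≤m+n _ _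
  ... | inj₂ gap = begin
    (2 + P) * wX + m * cY                         ≤⟨ ℕₚ.+-cancelʳ-≤ (2 + P) _ _ (begin
      (2 + P) * wX + m * cY + (2 + P)               ≡⟨ regroup₁ P wX (m * cY) ⟩
      (2 + P) * ℕ.suc wX + m * cY                   ≤⟨ ℕₚ.+-monoˡ-≤ (m * cY) (ℕₚ.*-monoʳ-≤ (2 + P) gap) ⟩
      (2 + P) * (wY + N) + m * cY                   ≡⟨ regroup₂ P wY N (m * cY) ⟩
      (2 + P) * wY + P * N + (2 * N + m * cY)       ≤⟨ ℕₚ.+-monoʳ-≤ ((2 + P) * wY + P * N) bound ⟩
      (2 + P) * wY + P * N + (2 + P)                ∎) ⟩
    (2 + P) * wY + P * N                          ≤⟨ ℕₚ.+-monoˡ-≤ (P * N) (ℕₚ.m≤m+n _ (m * cX)) ⟩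
    (2 + P) * wY + m * cX + P * N                 ∎
    where
    open ℕₚ.≤-Reasoning
    wX wY cX cY N m : ℕ
    wX = weight X d
    wY = weight Y d
    cX = card X
    cY = card Y
    N = cross X Y
    m = n ∸ 1
    three : ∀ x → 2 * x + x ≡ 3 * x
    three = solve-∀
    bound : 2 * N + m * cY ≤ 2 + P
    bound = begin
      2 * N + m * cY
        ≤⟨ ℕₚ.+-mono-≤ (ℕₚ.*-monoʳ-≤ 2 (cross≤ X Y)) (ℕₚ.*-mono-≤ (ℕₚ.m∸n≤m n 1) (card≤ Y)) ⟩
      2 * (n * n) + n * n     ≡⟨ three (n * n) ⟩
      3 * (n * n)             ≤⟨ ℕₚ.≤-trans 3n²≤P (ℕₚ.m≤n+m P 2) ⟩
      2 + P                   ∎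
    regroup₁ : ∀ P w c → (2 + P) * w + c + (2 + P) ≡ (2 + P) * ℕ.suc w + c
    regroup₁ = solve-∀
    regroup₂ : ∀ P w N c → (2 + P) * (w + N) + c ≡ (2 + P) * w + P * N + (2 * N + c)
    regroup₂ = solve-∀

pos-sum : ∀ {n} (f : Fin n → ℕ) → ℤΣ.sum (λ i → ℤ.+ f i) ≡ ℤ.+ ℕΣ.sum f
pos-sum {ℕ.zero}  f = refl
pos-sum {ℕ.suc n} f = trans (cong (ℤ._+_ (ℤ.+ f zero)) (pos-sum (f ∘ suc))) (sym (ℤₚ.pos-+ (f zero) _))

pos-weight : ∀ {n} (X : Fin n → Bool) (f : Fin n → ℕ) → ℤΣ.weight X (λ i → ℤ.+ f i) ≡ ℤ.+ ℕΣ.weight X f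
pos-weight X f = trans (ℤΣ.sum-cong-≗ (λ i → pointwise (X i))) (pos-sum (λ i → ℕΣ.[ X i ]· f i))
  where
  pointwise : ∀ p {x} → ℤΣ.[ p ]· (ℤ.+ x) ≡ ℤ.+ (ℕΣ.[ p ]· x)
  pointwise true  = refl
  pointwise false = refl

pos-cut : ∀ {n} (c : Fin n → Fin n → ℕ) X Y → ℤΣ.cut (λ u w → ℤ.+ c u w) X Y ≡ ℤ.+ ℕΣ.cut c X Y
pos-cut c X Y = trans (ℤΣ.sum-cong-≗ (λ u → pos-weight (λ w → X u ∧ not (Y w)) (c u)))
                      (pos-weight (λ _ → true) (λ u → ℕΣ.weight (λ w → X u ∧ not (Y w)) (c u)))

module Fractions where
  open import Data.Integer using (ℤ; 0ℤ; +_; _+_; _*_; _<_)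
  open import Data.Rational using (_/_; 0ℚ; 1ℚ; toℚᵘ) renaming (_+_ to _+ℚ_; _<_ to _<ℚ_)
  import Data.Rational.Properties as ℚₚ
  open import Data.Rational.Unnormalised using (mkℚᵘ; *≡*; *<*) renaming (_≃_ to _≃ᵘ_; _+_ to _+ᵘ_)
  import Data.Rational.Unnormalised.Properties as ℚᵘₚ
  open import Data.Integer.Tactic.RingSolver using (solve-∀)

  toℚᵘ-/ : ∀ i D → toℚᵘ (i / ℕ.suc D) ≃ᵘ mkℚᵘ i D
  toℚᵘ-/ i D = ℚₚ.toℚᵘ-fromℚᵘ (mkℚᵘ i D)

  /-+ : ∀ i j D → i / ℕ.suc D +ℚ j / ℕ.suc D ≡ (i + j) / ℕ.suc D
  /-+ i j D = ℚₚ.toℚᵘ-injective (ℚᵘₚ.≃-trans (ℚₚ.toℚᵘ-homo-+ (i / ℕ.suc D) (j / ℕ.suc D))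
    (ℚᵘₚ.≃-trans (ℚᵘₚ.+-cong (toℚᵘ-/ i D) (toℚᵘ-/ j D))
      (ℚᵘₚ.≃-trans same-denominator (ℚᵘₚ.≃-sym (toℚᵘ-/ (i + j) D)))))
    where
    same-denominator : mkℚᵘ i D +ᵘ mkℚᵘ j D ≃ᵘ mkℚᵘ (i + j) D
    same-denominator = *≡* (trans (regroup i j (+ ℕ.suc D))
                                  (cong ((i + j) *_) (sym (ℤₚ.pos-* (ℕ.suc D) (ℕ.suc D)))))
      where
      regroup : ∀ i j s → (i * s + j * s) * s ≡ (i + j) * (s * s)
      regroup = solve-∀

  sumℚ-/ : ∀ {n} (q : Fin n → ℚ) (m : Fin n → ℤ) D → (∀ j → q j ≡ m j / ℕ.suc D) → sumℚ q ≡ ℤΣ.sum m / ℕ.suc D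
  sumℚ-/ {ℕ.zero}  q m D q≡m/D = sym (ℚₚ.0/n≡0 (ℕ.suc D))
  sumℚ-/ {ℕ.suc n} q m D q≡m/D = trans (cong₂ _+ℚ_ (q≡m/D zero) (sumℚ-/ (q ∘ suc) (m ∘ suc) D (q≡m/D ∘ suc)))
                                       (/-+ (m zero) (ℤΣ.sum (m ∘ suc)) D)

  /-cancel : ∀ t D → + (ℕ.suc D ℕ.* t) / ℕ.suc D ≡ + t / 1
  /-cancel t D = ℚₚ.toℚᵘ-injective (ℚᵘₚ.≃-trans (toℚᵘ-/ (+ (ℕ.suc D ℕ.* t)) D)
    (ℚᵘₚ.≃-trans (*≡* cross-multiplied) (ℚᵘₚ.≃-sym (toℚᵘ-/ (+ t) 0))))
    where
    cross-multiplied : + (ℕ.suc D ℕ.* t) * + 1 ≡ + t * + ℕ.suc D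
    cross-multiplied = trans (ℤₚ.*-identityʳ _)
                             (trans (cong +_ (ℕₚ.*-comm (ℕ.suc D) t)) (ℤₚ.pos-* t (ℕ.suc D)))

  0</ : ∀ i D → 0ℤ < i → 0ℚ <ℚ i / ℕ.suc D
  0</ i D 0<i = ℚₚ.toℚᵘ-cancel-< (ℚᵘₚ.<-respʳ-≃ (ℚᵘₚ.≃-sym (toℚᵘ-/ i D))
                                               (*<* (subst (0ℤ <_) (sym (ℤₚ.*-identityʳ i)) 0<i)))

  /<1 : ∀ i D → i < + ℕ.suc D → i / ℕ.suc D <ℚ 1ℚ
  /<1 i D i<D = ℚₚ.toℚᵘ-cancel-< (ℚᵘₚ.<-respˡ-≃ (ℚᵘₚ.≃-sym (toℚᵘ-/ i D))
                 (*<* (subst₂ _<_ (sym (ℤₚ.*-identityʳ i)) (sym (ℤₚ.*-identityˡ _)) i<D)))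

module Construction {n} (d : Fin n → ℕ) (d>0 : ∀ i → 0 ℕ.< d i) (d↓ : NonIncreasing d)
                    (conditions : StrictConditions d) where
  open import Data.Integer using (ℤ; 0ℤ; +_; _+_; _-_; -_; _*_; _≤_; _<_; +≤+; +<+)
  open import Data.Integer.Tactic.RingSolver using (solve-∀)
  open import Data.Rational using (_/_)
  import Data.Nat.Tactic.RingSolver as ℕSolver
  open SupplyDemand
  open DegreeSequence
    using (offDiagonal; cross; card; gale-inequality; weight-scaled; weight-const; cut-scaled; card-∁-｛｝)
  open ℤΣ using (weight; cut; [_]·_; sum; sum-cong-≗; ∑-distrib-+; weight-difference)

  P : ℕ
  P = 3 ℕ.* (n ℕ.* n)

  supply : Fin n → ℤ
  supply u = + ((2 ℕ.+ P) ℕ.* d u) - + (n ℕ.∸ 1)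

  capacity : Fin n → Fin n → ℤ
  capacity u w = + (P ℕ.* offDiagonal u w)

  weight-supply : ∀ X → weight X supply ≡ + ((2 ℕ.+ P) ℕ.* ℕΣ.weight X d) - + ((n ℕ.∸ 1) ℕ.* card X)
  weight-supply X = trans (weight-difference X (λ u → + ((2 ℕ.+ P) ℕ.* d u)) (λ _ → + (n ℕ.∸ 1)))
    (cong₂ _-_ (trans (pos-weight X (λ u → (2 ℕ.+ P) ℕ.* d u)) (cong +_ (weight-scaled X (2 ℕ.+ P) d)))
               (trans (pos-weight X (λ _ → n ℕ.∸ 1)) (cong +_ (weight-const X (n ℕ.∸ 1)))))

  cut-capacity : ∀ X Y → cut capacity X Y ≡ + (P ℕ.* cross X Y)
  cut-capacity X Y = trans (pos-cut (λ u w → P ℕ.* offDiagonal u w) X Y)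
                           (cong +_ (cut-scaled P offDiagonal X Y))

  gale : GaleCondition capacity supply supply
  gale X Y = subst₂ (λ r s → r ≤ s + cut capacity X Y) (sym (weight-supply X)) (sym (weight-supply Y))
    (subst (λ t → + a - + b ≤ + c - + e + t) (sym (cut-capacity X Y))
      (lift a b c e (P ℕ.* cross X Y) (gale-inequality d>0 d↓ conditions P ℕₚ.≤-refl X Y)))
    where
    a b c e : ℕ
    a = (2 ℕ.+ P) ℕ.* ℕΣ.weight X d
    b = (n ℕ.∸ 1) ℕ.* card X
    c = (2 ℕ.+ P) ℕ.* ℕΣ.weight Y d
    e = (n ℕ.∸ 1) ℕ.* card Y
    lift : ∀ a b c e f → a ℕ.+ e ℕ.≤ c ℕ.+ b ℕ.+ f → + a - + b ≤ + c - + e + + f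
    lift a b c e f h = ≤-shift (- + b - + e)
      (subst₂ _≤_ (ℤₚ.pos-+ a e) (trans (ℤₚ.pos-+ (c ℕ.+ b) f) (cong (_+ + f) (ℤₚ.pos-+ c b))) (+≤+ h))
      (lhs (+ a) (+ b) (+ e)) (rhs (+ b) (+ c) (+ e) (+ f))
      where
      lhs : ∀ a b e → a + e + (- b - e) ≡ a - b
      lhs = solve-∀
      rhs : ∀ b c e f → c + b + f + (- b - e) ≡ c - e + f
      rhs = solve-∀

  -- Opaque, as otherwise every goal mentioning x unfolds the whole construction of the flow.
  opaque
    flow : Σ (Fin n → Fin n → ℤ) (IsFlow capacity supply supply)
    flow = supply-demand capacity supply supply (λ _ _ → +≤+ ℕ.z≤n) refl gale

  x : Fin n → Fin n → ℤ
  x = proj₁ flow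

  open IsFlow (proj₂ flow)

  x-diagonal : ∀ k → x k k ≡ 0ℤ
  x-diagonal k = ℤₚ.≤-antisym (subst (x k k ≤_) capacity-diagonal (bounded k k)) (nonneg k k)
    where
    capacity-diagonal : capacity k k ≡ 0ℤ
    capacity-diagonal = trans (cong (λ b → + (P ℕ.* ℕΣ.[ not b ]· 1)) (dec-true (k ≟ k) refl))
                              (cong +_ (ℕₚ.*-zeroʳ P))

  x≤P : ∀ j k → j ≢ k → x j k ≤ + P
  x≤P j k j≢k = subst (x j k ≤_) capacity-off-diagonal (bounded j k)
    where
    capacity-off-diagonal : capacity j k ≡ + P
    capacity-off-diagonal = trans (cong (λ b → + (P ℕ.* ℕΣ.[ not b ]· 1)) (dec-false (j ≟ k) j≢k))
                                  (cong +_ (ℕₚ.*-identityʳ P))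

  numerator : Fin n → Fin n → ℤ
  numerator j k = + 2 + x j k + x k j

  D : ℕ
  D = 3 ℕ.+ 2 ℕ.* P

  y : Fin n → Fin n → ℚ
  y j k = numerator j k / ℕ.suc D

  y-symmetric : Symmetric y
  y-symmetric j k = cong (_/ ℕ.suc D) (swap (x j k) (x k j))
    where
    swap : ∀ s t → + 2 + s + t ≡ + 2 + t + s
    swap = solve-∀

  numerator-degree : ∀ k → sum (λ j → [ not (does (j ≟ k)) ]· numerator j k) ≡ + (ℕ.suc D ℕ.* d k)
  numerator-degree k = begin
    sum (λ j → [ not (does (j ≟ k)) ]· numerator j k)
      ≡⟨ sum-cong-≗ split ⟩
    sum (λ j → [ not (does (j ≟ k)) ]· (+ 2) + x j k + x k j)
      ≡⟨ ∑-distrib-+ (λ j → [ not (does (j ≟ k)) ]· (+ 2) + x j k) (λ j → x k j) ⟩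
    sum (λ j → [ not (does (j ≟ k)) ]· (+ 2) + x j k) + sum (x k)
      ≡⟨ cong (_+ sum (x k)) (∑-distrib-+ (λ j → [ not (does (j ≟ k)) ]· (+ 2)) (λ j → x j k)) ⟩
    weight (not ∘ ｛ k ｝) (λ _ → + 2) + sum (λ j → x j k) + sum (x k)
      ≡⟨ cong₂ (λ s t → s + t + sum (x k)) twos (colSum k) ⟩
    + (2 ℕ.* (n ℕ.∸ 1)) + supply k + sum (x k)
      ≡⟨ cong (_+_ (+ (2 ℕ.* (n ℕ.∸ 1)) + supply k)) (rowSum k) ⟩
    + (2 ℕ.* (n ℕ.∸ 1)) + supply k + supply k
      ≡⟨ cong₂ (λ s t → s + (t - + (n ℕ.∸ 1)) + (t - + (n ℕ.∸ 1)))
               (ℤₚ.pos-* 2 (n ℕ.∸ 1)) (ℤₚ.pos-* (2 ℕ.+ P) (d k)) ⟩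
    + 2 * + (n ℕ.∸ 1) + ((+ 2 + + P) * + d k - + (n ℕ.∸ 1)) + ((+ 2 + + P) * + d k - + (n ℕ.∸ 1))
      ≡⟨ doubled (+ (n ℕ.∸ 1)) (+ P) (+ d k) ⟩
    (+ 4 + + 2 * + P) * + d k
      ≡⟨ cong (λ t → (+ 4 + t) * + d k) (ℤₚ.pos-* 2 P) ⟨
    + (4 ℕ.+ 2 ℕ.* P) * + d k
      ≡⟨ ℤₚ.pos-* (4 ℕ.+ 2 ℕ.* P) (d k) ⟨
    + (ℕ.suc D ℕ.* d k) ∎
    where
    open ≡-Reasoning
    split : ∀ j → [ not (does (j ≟ k)) ]· numerator j k ≡ [ not (does (j ≟ k)) ]· (+ 2) + x j k + x k j
    split j with j ≟ k
    ... | yes refl rewrite x-diagonal j = refl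
    ... | no _     = refl
    twos : weight (not ∘ ｛ k ｝) (λ _ → + 2) ≡ + (2 ℕ.* (n ℕ.∸ 1))
    twos = trans (pos-weight (not ∘ ｛ k ｝) (λ _ → 2))
                 (cong +_ (trans (weight-const (not ∘ ｛ k ｝) 2) (cong (2 ℕ.*_) (card-∁-｛｝ k))))
    doubled : ∀ m p t → + 2 * m + ((+ 2 + p) * t - m) + ((+ 2 + p) * t - m) ≡ (+ 4 + + 2 * p) * t
    doubled = solve-∀

  y-degree : ∀ k → degreeAt y k ≡ + d k / 1
  y-degree k = trans (Fractions.sumℚ-/ _ (λ j → [ not (does (j ≟ k)) ]· numerator j k) D zero-on-diagonal)
                     (trans (cong (_/ ℕ.suc D) (numerator-degree k)) (Fractions./-cancel (d k) D))
    where
    zero-on-diagonal : ∀ j → (if ⌊ j ≟ k ⌋ then 0ℚ else y j k)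
                             ≡ ([ not (does (j ≟ k)) ]· numerator j k) / ℕ.suc D
    zero-on-diagonal j rewrite isYes≗does (j ≟ k) with does (j ≟ k)
    ... | true  = sym (ℚₚ.0/n≡0 (ℕ.suc D))
    ... | false = refl

  y-strict : StrictlyInside y
  y-strict j k j≢k = Fractions.0</ (numerator j k) D 0<numerator
                   , Fractions./<1 (numerator j k) D numerator<
    where
    0<numerator : 0ℤ < numerator j k
    0<numerator = ℤₚ.<-≤-trans (+<+ (ℕ.s≤s ℕ.z≤n))
                    (ℤₚ.+-mono-≤ (ℤₚ.+-mono-≤ (ℤₚ.≤-refl {+ 2}) (nonneg j k)) (nonneg k j))
    numerator< : numerator j k < + ℕ.suc D
    numerator< = ℤₚ.≤-<-trans
      (ℤₚ.+-mono-≤ (ℤₚ.+-mono-≤ (ℤₚ.≤-refl {+ 2}) (x≤P j k j≢k)) (x≤P k j (j≢k ∘ sym)))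
      (+<+ (ℕₚ.≤-trans (ℕₚ.≤-reflexive (bound P)) (ℕₚ.n≤1+n D)))
      where
      bound : ∀ p → ℕ.suc (2 ℕ.+ p ℕ.+ p) ≡ 3 ℕ.+ 2 ℕ.* p
      bound = ℕSolver.solve-∀

lemma12p2 : (n : ℕ) (d : Fin n → ℕ)
    → (∀ (i : Fin n) → 0 ℕ.< d i)
    → NonIncreasing d
    → StrictConditions d
    → Σ (Fin n → Fin n → ℚ) (λ y → InP d y × StrictlyInside y)
lemma12p2 n d d>0 d↓ conditions = y , (y-symmetric , y-degree , bounds) , y-strict
  where
  open Construction d d>0 d↓ conditions
  bounds : ∀ j k → j ≢ k → (0ℚ ℚ.≤ y j k) × (y j k ℚ.≤ 1ℚ)
  bounds j k j≢k = ℚₚ.<⇒≤ (proj₁ (y-strict j k j≢k)) , ℚₚ.<⇒≤ (proj₂ (y-strict j k j≢k))
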